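{- Let $n,k$ be positive integers with $n\ge k$ and $n\ge 3(n-k)$, and let $i\in\{0,1,\dots,n-k\}$. Let $C$ be any linear chord diagram with $n$ chords in which every chord has length at least $k$, and let $\alpha_{n,k,i}(C)$ be the diagram defined below. Then $\alpha_{n,k,i}(C)$ is a linear chord diagram with $n+1$ chords in which every chord has length at least $k+1$. Definition of $\alpha_{n,k,i}(C)$: Let $M_{n,k}=\{k+1,\dots,2n-k\}$ and let $S_C$ be the set of chords of $C$ having neither endpoint in $M_{n,k}$. First form a diagram $C^*$ on $\{1,\dots,2n+2\}$ by inserting a new chord $c$ whose start point is placed immediately before the positions of $M_{n,k}$ and whose end point is placed immediately after them: the points $1,\dots,k$ keep their labels, $c$ starts at $k+1$, the old points $k+1,\dots,2n-k$ become $k+2,\dots,2n-k+1$, $c$ ends at $2n-k+2$, and the old points $2n-k+1,\dots,2n$ become $2n-k+3,\dots,2n+2$, all old chords keeping their partners. Then repeatedly exchange the start point of $c$ with the start point of the chord of $S_C$ whose start point is the closest one to the left of the current start point of $c$ (i.e. $c$ takes that position and that chord takes $c$'s previous start position), stopping as soon as exactly $i$ chords of $S_C$ have start points to the left of the start point of $c$. The resulting diagram is $\alpha_{n,k,i}(C)$.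
   Context: A linear chord diagram with $N$ chords is a partition of $\{1,2,\dots,2N\}$ into blocks of size two, called chords. For a chord $c=\{s_c,e_c\}$ with $s_c<e_c$, $s_c$ is its start point, $e_c$ its end point, and its length is $e_c-s_c$. Under the hypotheses, every chord of $S_C$ starts in $\{1,\dots,k\}$ and $|S_C|\ge n-k$, so the construction is well defined. -}

module Defs where

open import Data.Nat using (ℕ; zero; suc; _+_; _*_; _∸_; _≤_; _<_; _≤ᵇ_; _<ᵇ_; _≡ᵇ_)
open import Data.Bool using (Bool; true; false; if_then_else_; _∧_; not)
open import Data.Maybe using (Maybe; just; nothing)
open import Data.Product using (_×_)
open import Relation.Binary.PropositionalEquality using (_≡_; _≢_)

-- A linear chord diagram with N chords on points 1..2N is encoded by its
-- "partner" function m : ℕ → ℕ (values outside 1..2N are irrelevant):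
-- the chords are the pairs {x, m x}.  m must be a fixed-point-free
-- involution of {1,…,2N}; this is exactly a partition of {1..2N} into
-- blocks of size two.
IsLCD : ℕ → (ℕ → ℕ) → Set
IsLCD N m = ∀ x → 1 ≤ x → x ≤ 2 * N →
  (1 ≤ m x) × (m x ≤ 2 * N) × (m x ≢ x) × (m (m x) ≡ x)

MinLen : ℕ → ℕ → (ℕ → ℕ) → Set
MinLen N k m = ∀ x → 1 ≤ x → x ≤ 2 * N → x < m x → k ≤ m x ∸ x

countUpTo : (ℕ → Bool) → ℕ → ℕ
countUpTo P zero = zero
countUpTo P (suc m) = if P (suc m) then suc (countUpTo P m) else countUpTo P m

largestUpTo : (ℕ → Bool) → ℕ → Maybe ℕ
largestUpTo P zero = nothing
largestUpTo P (suc m) = if P (suc m) then just (suc m) else largestUpTo P m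

swapPts : ℕ → ℕ → (ℕ → ℕ) → (ℕ → ℕ)
swapPts p q D x = τ (D (τ x))
  where
  τ : ℕ → ℕ
  τ y = if y ≡ᵇ p then q else (if y ≡ᵇ q then p else y)

module Alpha (n k i : ℕ) (C : ℕ → ℕ) where

  inM : ℕ → Bool
  inM x = (k <ᵇ x) ∧ (x ≤ᵇ 2 * n ∸ k)

  σ : ℕ → ℕ
  σ x = if x ≤ᵇ k then x else (if x ≤ᵇ 2 * n ∸ k then suc x else suc (suc x))

  -- inverse relabelling (on points other than the two endpoints of c)
  σinv : ℕ → ℕ
  σinv y = if y ≤ᵇ k then y else (if y ≤ᵇ suc (2 * n ∸ k) then y ∸ 1 else y ∸ 2)

  cEnd : ℕ
  cEnd = 2 * n ∸ k + 2

  Cstar : ℕ → ℕ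
  Cstar y = if y ≡ᵇ suc k then cEnd
            else (if y ≡ᵇ cEnd then suc k else σ (C (σinv y)))

  inS : ℕ → Bool
  inS y = not (y ≡ᵇ suc k) ∧ not (y ≡ᵇ cEnd)
          ∧ not (inM (σinv y)) ∧ not (inM (C (σinv y)))

  -- position q of the current diagram D is the start point of a chord of S_C
  -- (end points never move during the exchanges, so the chord is identified
  -- by its end point D q)
  isSStart : (ℕ → ℕ) → ℕ → Bool
  isSStart D q = (q <ᵇ D q) ∧ inS (D q)

  -- the exchange process; p is the current start point of c; fuel bounds the
  -- number of exchanges (2n+2 is more than enough)
  run : ℕ → (ℕ → ℕ) → ℕ → (ℕ → ℕ)
  run zero D p = D
  run (suc f) D p =
    if countUpTo (isSStart D) (p ∸ 1) ≡ᵇ i then D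
    else step (largestUpTo (isSStart D) (p ∸ 1))
    where
    step : Maybe ℕ → (ℕ → ℕ)
    step nothing = D
    step (just q) = run f (swapPts p q D) q

  result : ℕ → ℕ
  result = run (2 * n + 2) Cstar (suc k)

α : ℕ → ℕ → ℕ → (ℕ → ℕ) → (ℕ → ℕ)
α n k i C = Alpha.result n k i C

module Submission where

-- Put d = n - k and B = 2n - k, so M = {k+1,…,B} has 2d points
-- and the hypothesis 3d ≤ n reads 2d ≤ k.  Since C has minimum length k, the
-- points 1..k are start points, the points beyond B are end points, and every
-- chord goes low–M, low–high or M–high.  Sweeping a cut from k to 2n counts
-- them: exactly d chords go from 1..k into M, the others (the chords of S_C)
-- end beyond B.  In C* every old chord has length ≥ k+1, and c = {p, cEnd}
-- with cEnd = k + 2d + 2.  Each exchange moves c from p to the largest S_C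
-- start q < p and the chord {q, e} to {p, e}; this stays long because every
-- point strictly between q and p starts a chord ending in M, left of e.
-- When the process stops at most i ≤ d chords of S_C start left of c, and
-- at most d other chords do, so p ≤ 2d + 1 and c has length ≥ k+1 as well.

open import Defs
open import Data.Nat
open import Data.Nat.Properties
open import Data.Nat.Tactic.RingSolver using (solve-∀)
open import Data.Bool using (Bool; true; false; if_then_else_; _∧_; not; T)
open import Data.Bool.Properties using (∧-identityʳ)
open import Data.Maybe using (just; nothing)
open import Data.Product using (_×_; _,_; proj₁; proj₂)
open import Data.Sum using (inj₁; inj₂)
open import Data.Empty using (⊥-elim)
open import Data.Unit using (tt)
open import Function using (_∘_)
open import Relation.Nullary using (¬_; yes; no)
open import Relation.Binary.PropositionalEquality
open import Relation.Binary.Definitions using (tri<; tri≈; tri>)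

≡true⇒T : ∀ {b} → b ≡ true → T b
≡true⇒T refl = tt

¬T⇒≡false : ∀ {b} → ¬ T b → b ≡ false
¬T⇒≡false {false} _ = refl
¬T⇒≡false {true} ¬t = ⊥-elim (¬t tt)

T⇒≡true : ∀ {b} → T b → b ≡ true
T⇒≡true {true} _ = refl

≡false⇒¬T : ∀ {b} → b ≡ false → ¬ T b
≡false⇒¬T refl ()

<⇒<ᵇ≡true : ∀ {m n} → m < n → (m <ᵇ n) ≡ true
<⇒<ᵇ≡true p = T⇒≡true (<⇒<ᵇ p)

≥⇒<ᵇ≡false : ∀ {m n} → n ≤ m → (m <ᵇ n) ≡ false
≥⇒<ᵇ≡false {m} {n} p = ¬T⇒≡false (λ t → <⇒≱ (<ᵇ⇒< m n t) p)

<ᵇ≡true⇒< : ∀ {m n} → (m <ᵇ n) ≡ true → m < n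
<ᵇ≡true⇒< {m} {n} e = <ᵇ⇒< m n (≡true⇒T e)

<ᵇ≡false⇒≥ : ∀ {m n} → (m <ᵇ n) ≡ false → n ≤ m
<ᵇ≡false⇒≥ e = ≮⇒≥ (λ p → ≡false⇒¬T e (<⇒<ᵇ p))

≤⇒≤ᵇ≡true : ∀ {m n} → m ≤ n → (m ≤ᵇ n) ≡ true
≤⇒≤ᵇ≡true p = T⇒≡true (≤⇒≤ᵇ p)

>⇒≤ᵇ≡false : ∀ {m n} → n < m → (m ≤ᵇ n) ≡ false
>⇒≤ᵇ≡false {m} {n} p = ¬T⇒≡false (λ t → <⇒≱ p (≤ᵇ⇒≤ m n t))

≡ᵇ-refl : ∀ m → (m ≡ᵇ m) ≡ true
≡ᵇ-refl m = T⇒≡true (≡⇒≡ᵇ m m refl)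

≢⇒≡ᵇ≡false : ∀ {m n} → m ≢ n → (m ≡ᵇ n) ≡ false
≢⇒≡ᵇ≡false {m} {n} p = ¬T⇒≡false (λ t → p (≡ᵇ⇒≡ m n t))

≡ᵇ≡true⇒≡ : ∀ {m n} → (m ≡ᵇ n) ≡ true → m ≡ n
≡ᵇ≡true⇒≡ {m} {n} e = ≡ᵇ⇒≡ m n (≡true⇒T e)

count-suc-true : ∀ (P : ℕ → Bool) m → P (suc m) ≡ true →
  countUpTo P (suc m) ≡ suc (countUpTo P m)
count-suc-true P m e rewrite e = refl

count-suc-false : ∀ (P : ℕ → Bool) m → P (suc m) ≡ false →
  countUpTo P (suc m) ≡ countUpTo P m
count-suc-false P m e rewrite e = refl

count-cong : ∀ (P Q : ℕ → Bool) m → (∀ x → 1 ≤ x → x ≤ m → P x ≡ Q x) →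
  countUpTo P m ≡ countUpTo Q m
count-cong P Q zero h = refl
count-cong P Q (suc m) h
  rewrite h (suc m) (s≤s z≤n) ≤-refl
        | count-cong P Q m (λ x a b → h x a (m≤n⇒m≤1+n b)) = refl

count-one : ∀ (P Q : ℕ → Bool) m x0 → 1 ≤ x0 → x0 ≤ m → P x0 ≡ true → Q x0 ≡ false →
  (∀ x → 1 ≤ x → x ≤ m → x ≢ x0 → P x ≡ Q x) →
  countUpTo P m ≡ suc (countUpTo Q m)
count-one P Q zero x0 a b _ _ _ = ⊥-elim (<⇒≱ a b)
count-one P Q (suc m) x0 a b px qx h with suc m ≟ x0
... | yes refl rewrite px | qx
      | count-cong P Q m (λ x c e → h x c (m≤n⇒m≤1+n e) (<⇒≢ (s≤s e))) = refl
... | no ne rewrite h (suc m) (s≤s z≤n) ≤-refl ne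
      | count-one P Q m x0 a (≤-pred (≤∧≢⇒< b (ne ∘ sym))) px qx
          (λ x c e → h x c (m≤n⇒m≤1+n e)) with Q (suc m)
...   | true = refl
...   | false = refl

count-≤ : ∀ (P : ℕ → Bool) m → countUpTo P m ≤ m
count-≤ P zero = z≤n
count-≤ P (suc m) with P (suc m)
... | true = s≤s (count-≤ P m)
... | false = m≤n⇒m≤1+n (count-≤ P m)

count-all : ∀ (P : ℕ → Bool) m → (∀ x → 1 ≤ x → x ≤ m → P x ≡ true) →
  countUpTo P m ≡ m
count-all P zero h = refl
count-all P (suc m) h rewrite h (suc m) (s≤s z≤n) ≤-refl
  = cong suc (count-all P m (λ x a b → h x a (m≤n⇒m≤1+n b)))

count-none : ∀ (P : ℕ → Bool) m → (∀ x → 1 ≤ x → x ≤ m → P x ≡ false) →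
  countUpTo P m ≡ 0
count-none P zero h = refl
count-none P (suc m) h rewrite h (suc m) (s≤s z≤n) ≤-refl
  = count-none P m (λ x a b → h x a (m≤n⇒m≤1+n b))

count-mono : ∀ (P : ℕ → Bool) {m m′} → m ≤ m′ → countUpTo P m ≤ countUpTo P m′
count-mono P {m} {zero} z≤n = ≤-refl
count-mono P {m} {suc m′} le with m≤n⇒m<n∨m≡n le
... | inj₂ refl = ≤-refl
... | inj₁ lt = ≤-trans (count-mono P (≤-pred lt)) step
  where
  step : countUpTo P m′ ≤ countUpTo P (suc m′)
  step with P (suc m′)
  ... | true = n≤1+n _
  ... | false = ≤-refl

count-partition : ∀ (P : ℕ → Bool) m →
  countUpTo P m + countUpTo (λ x → not (P x)) m ≡ m
count-partition P zero = refl
count-partition P (suc m) with P (suc m)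
... | true = cong suc (count-partition P m)
... | false = trans (+-suc _ _) (cong suc (count-partition P m))

largest-nothing : ∀ (P : ℕ → Bool) m → largestUpTo P m ≡ nothing → countUpTo P m ≡ 0
largest-nothing P zero e = refl
largest-nothing P (suc m) e with P (suc m)
largest-nothing P (suc m) () | true
largest-nothing P (suc m) e | false = largest-nothing P m e

record Largest (P : ℕ → Bool) (m q : ℕ) : Set where
  field
    q≥1 : 1 ≤ q
    q≤m : q ≤ m
    Pq : P q ≡ true
    above : ∀ y → q < y → y ≤ m → P y ≡ false
    count-below : countUpTo P m ≡ suc (countUpTo P (pred q))

largest-just : ∀ (P : ℕ → Bool) m q → largestUpTo P m ≡ just q → Largest P m q
largest-just P zero q ()
largest-just P (suc m) q e with P (suc m) in Pm
largest-just P (suc m) q refl | true = record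
  { q≥1 = s≤s z≤n ; q≤m = ≤-refl ; Pq = Pm
  ; above = λ y a b → ⊥-elim (<⇒≱ a b) ; count-below = count-suc-true P m Pm }
largest-just P (suc m) q e | false = record
  { q≥1 = q≥1 ; q≤m = m≤n⇒m≤1+n q≤m ; Pq = Pq ; above = above′
  ; count-below = trans (count-suc-false P m Pm) count-below }
  where
  open Largest (largest-just P m q e)
  above′ : ∀ y → q < y → y ≤ suc m → P y ≡ false
  above′ y a b with m≤n⇒m<n∨m≡n b
  ... | inj₁ lt = above y a (≤-pred lt)
  ... | inj₂ refl = Pm

transposition : ℕ → ℕ → ℕ → ℕ
transposition p q y = if y ≡ᵇ p then q else (if y ≡ᵇ q then p else y)

transposition-p : ∀ p q → transposition p q p ≡ q
transposition-p p q rewrite ≡ᵇ-refl p = refl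

transposition-q : ∀ p q → transposition p q q ≡ p
transposition-q p q with q ≟ p
... | yes refl rewrite ≡ᵇ-refl q = refl
... | no ne rewrite ≢⇒≡ᵇ≡false ne | ≡ᵇ-refl q = refl

transposition-other : ∀ p q y → y ≢ p → y ≢ q → transposition p q y ≡ y
transposition-other p q y a b rewrite ≢⇒≡ᵇ≡false a | ≢⇒≡ᵇ≡false b = refl

transposition-involutive : ∀ p q y → transposition p q (transposition p q y) ≡ y
transposition-involutive p q y with y ≟ p
... | yes refl rewrite transposition-p y q = transposition-q y q
... | no a with y ≟ q
...   | yes refl rewrite transposition-q p y = transposition-p p y
...   | no b rewrite transposition-other p q y a b = transposition-other p q y a b

transposition-range : ∀ N p q y → 1 ≤ p → p ≤ N → 1 ≤ q → q ≤ N → 1 ≤ y → y ≤ N →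
  (1 ≤ transposition p q y) × (transposition p q y ≤ N)
transposition-range N p q y p1 pN q1 qN y1 yN with y ≟ p
... | yes refl rewrite transposition-p y q = q1 , qN
... | no a with y ≟ q
...   | yes refl rewrite transposition-q p y = p1 , pN
...   | no b rewrite transposition-other p q y a b = y1 , yN

swap-IsLCD : ∀ N D p q → IsLCD N D → 1 ≤ p → p ≤ 2 * N → 1 ≤ q → q ≤ 2 * N →
  IsLCD N (swapPts p q D)
swap-IsLCD N D p q lcd p1 pN q1 qN x x1 xN = proj₁ rng , proj₂ rng , no-fix , invol
  where
  τ : ℕ → ℕ
  τ = transposition p q
  y : ℕ
  y = τ x
  y-rng : (1 ≤ y) × (y ≤ 2 * N)
  y-rng = transposition-range (2 * N) p q x p1 pN q1 qN x1 xN
  Dy : (1 ≤ D y) × (D y ≤ 2 * N) × (D y ≢ y) × (D (D y) ≡ y)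
  Dy = lcd y (proj₁ y-rng) (proj₂ y-rng)
  rng : (1 ≤ τ (D y)) × (τ (D y) ≤ 2 * N)
  rng = transposition-range (2 * N) p q (D y) p1 pN q1 qN (proj₁ Dy) (proj₁ (proj₂ Dy))
  no-fix : τ (D y) ≢ x
  no-fix e = proj₁ (proj₂ (proj₂ Dy))
    (trans (sym (transposition-involutive p q (D y))) (cong τ e))
  invol : τ (D (τ (τ (D y)))) ≡ x
  invol rewrite transposition-involutive p q (D y) | proj₂ (proj₂ (proj₂ Dy)) =
    transposition-involutive p q x

module Crossing (N : ℕ) (C : ℕ → ℕ) (lcd : IsLCD N C) where

  beyond : ℕ → ℕ → ℕ
  beyond t m = countUpTo (λ x → t <ᵇ C x) m

  crossing : ℕ → ℕ
  crossing t = beyond t t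

  involutive : ∀ x → 1 ≤ x → x ≤ 2 * N → C (C x) ≡ x
  involutive x a b = proj₂ (proj₂ (proj₂ (lcd x a b)))

  partner-unique : ∀ x y → 1 ≤ x → x ≤ 2 * N → 1 ≤ y → y ≤ 2 * N → C x ≡ C y → x ≡ y
  partner-unique x y x1 xN y1 yN e =
    trans (sym (involutive x x1 xN)) (trans (cong C e) (involutive y y1 yN))

  <ᵇ-shift : ∀ t c → c ≢ suc t → (t <ᵇ c) ≡ (suc t <ᵇ c)
  <ᵇ-shift t c ne with <-cmp c (suc t)
  ... | tri< lt _ _ rewrite ≥⇒<ᵇ≡false {t} {c} (≤-pred lt) | ≥⇒<ᵇ≡false {suc t} {c} (<⇒≤ lt) = refl
  ... | tri≈ _ e _ = ⊥-elim (ne e)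
  ... | tri> _ _ gt rewrite <⇒<ᵇ≡true {t} {c} (<-trans (n<1+n t) gt) | <⇒<ᵇ≡true {suc t} {c} gt = refl

  beyond-pass : ∀ t m → (∀ x → 1 ≤ x → x ≤ m → C x ≢ suc t) → beyond (suc t) m ≡ beyond t m
  beyond-pass t m h = sym (count-cong _ _ m (λ x a b → <ᵇ-shift t (C x) (h x a b)))

  beyond-pass-partner : ∀ t m x₀ → 1 ≤ x₀ → x₀ ≤ m → m ≤ 2 * N → C x₀ ≡ suc t →
    beyond t m ≡ suc (beyond (suc t) m)
  beyond-pass-partner t m x₀ a b mN e = count-one _ _ m x₀ a b
    (subst (λ z → (t <ᵇ z) ≡ true) (sym e) (<⇒<ᵇ≡true (n<1+n t)))
    (subst (λ z → (suc t <ᵇ z) ≡ false) (sym e) (≥⇒<ᵇ≡false {suc t} ≤-refl))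
    (λ x c f ne → <ᵇ-shift t (C x) (λ e′ →
      ne (partner-unique x x₀ c (≤-trans f mN) a (≤-trans b mN) (trans e′ (sym e)))))

  start-partner-right : ∀ t m → m ≤ t → suc t ≤ 2 * N → suc t < C (suc t) →
    ∀ x → 1 ≤ x → x ≤ m → C x ≢ suc t
  start-partner-right t m mt tN lt x a b e =
    <⇒≱ lt (≤-trans (≤-reflexive (trans (cong C (sym e)) (involutive x a xN))) (≤-trans b (m≤n⇒m≤1+n mt)))
    where
    xN : x ≤ 2 * N
    xN = ≤-trans b (≤-trans mt (≤-trans (n≤1+n t) tN))

  crossing-start : ∀ t → suc t ≤ 2 * N → suc t < C (suc t) → crossing (suc t) ≡ suc (crossing t)
  crossing-start t tN lt = begin
    crossing (suc t)          ≡⟨ count-suc-true _ t (<⇒<ᵇ≡true lt) ⟩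
    suc (beyond (suc t) t)    ≡⟨ cong suc (beyond-pass t t (start-partner-right t t ≤-refl tN lt)) ⟩
    suc (crossing t)          ∎
    where open ≡-Reasoning

  crossing-end : ∀ t → suc t ≤ 2 * N → C (suc t) < suc t → crossing t ≡ suc (crossing (suc t))
  crossing-end t tN gt = begin
    crossing t                ≡⟨ beyond-pass-partner t t (C (suc t)) partner-pos (≤-pred gt) tN′
                                   (involutive (suc t) (s≤s z≤n) tN) ⟩
    suc (beyond (suc t) t)    ≡⟨ cong suc (sym (count-suc-false _ t (≥⇒<ᵇ≡false (<⇒≤ gt)))) ⟩
    suc (crossing (suc t))    ∎
    where
    open ≡-Reasoning
    tN′ : t ≤ 2 * N
    tN′ = ≤-trans (n≤1+n t) tN
    partner-pos : 1 ≤ C (suc t)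
    partner-pos = proj₁ (lcd (suc t) (s≤s z≤n) tN)

  crossing-at-end : crossing (2 * N) ≡ 0
  crossing-at-end = count-none _ (2 * N) (λ x a b → ≥⇒<ᵇ≡false (proj₁ (proj₂ (lcd x a b))))

module Construction (n k i : ℕ) (C : ℕ → ℕ) (k≥1 : 1 ≤ k) (k≤n : k ≤ n)
  (3d≤n : 3 * (n ∸ k) ≤ n) (i≤d : i ≤ n ∸ k) (lcd : IsLCD n C) (minLen : MinLen n k C) where
  open Alpha n k i C
  open Crossing n C lcd

  d : ℕ
  d = n ∸ k

  B : ℕ
  B = 2 * n ∸ k

  n≡k+d : n ≡ k + d
  n≡k+d = sym (m+[n∸m]≡n k≤n)

  2d≤k : d + d ≤ k
  2d≤k = +-cancelʳ-≤ d (d + d) k (subst₂ _≤_ (three d) n≡k+d 3d≤n)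
    where
    three : ∀ d → 3 * d ≡ d + d + d
    three = solve-∀

  2n≡k+k+2d : 2 * n ≡ k + (k + (d + d))
  2n≡k+k+2d = trans (cong (2 *_) n≡k+d) (expand k d)
    where
    expand : ∀ k d → 2 * (k + d) ≡ k + (k + (d + d))
    expand = solve-∀

  B≡k+2d : B ≡ k + (d + d)
  B≡k+2d = trans (cong (_∸ k) 2n≡k+k+2d) (m+n∸m≡n k _)

  2n≡k+B : 2 * n ≡ k + B
  2n≡k+B = trans 2n≡k+k+2d (cong (k +_) (sym B≡k+2d))

  k≤B : k ≤ B
  k≤B = subst (k ≤_) (sym B≡k+2d) (m≤m+n k _)

  B≤2k : B ≤ k + k
  B≤2k = subst (_≤ k + k) (sym B≡k+2d) (+-monoʳ-≤ k 2d≤k)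

  B≤2n : B ≤ 2 * n
  B≤2n = subst (B ≤_) (sym 2n≡k+B) (m≤n+m B k)

  k≤2n : k ≤ 2 * n
  k≤2n = ≤-trans k≤B B≤2n

  cEnd≡B+2 : cEnd ≡ suc (suc B)
  cEnd≡B+2 = +-comm B 2

  partner-≥1 : ∀ x → 1 ≤ x → x ≤ 2 * n → 1 ≤ C x
  partner-≥1 x a b = proj₁ (lcd x a b)

  partner-≤2n : ∀ x → 1 ≤ x → x ≤ 2 * n → C x ≤ 2 * n
  partner-≤2n x a b = proj₁ (proj₂ (lcd x a b))

  partner-≢ : ∀ x → 1 ≤ x → x ≤ 2 * n → C x ≢ x
  partner-≢ x a b = proj₁ (proj₂ (proj₂ (lcd x a b)))

  start-length : ∀ x → 1 ≤ x → x ≤ 2 * n → x < C x → k + x ≤ C x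
  start-length x a b c = subst (k + x ≤_) (m∸n+n≡m (<⇒≤ c)) (+-monoˡ-≤ x (minLen x a b c))

  end-length : ∀ x → 1 ≤ x → x ≤ 2 * n → C x < x → k + C x ≤ x
  end-length x a b gt = subst (k + C x ≤_) (involutive x a b)
    (start-length (C x) (partner-≥1 x a b) (partner-≤2n x a b)
      (subst (C x <_) (sym (involutive x a b)) gt))

  -- a point of 1..k cannot be an end: its partner would lie left of 1
  low-start : ∀ x → 1 ≤ x → x ≤ k → k + x ≤ C x
  low-start x a b = start-length x a xN (≤∧≢⇒< (≮⇒≥ not-end) (≢-sym (partner-≢ x a xN)))
    where
    xN : x ≤ 2 * n
    xN = ≤-trans b k≤2n
    not-end : ¬ (C x < x)
    not-end gt = <⇒≱ (m<m+n k (partner-≥1 x a xN)) (≤-trans (end-length x a xN gt) b)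

  -- a point beyond B cannot be a start: its partner would lie beyond 2n
  high-end : ∀ x → B < x → x ≤ 2 * n → C x < x
  high-end x a b = ≤∧≢⇒< (≮⇒≥ not-start) (partner-≢ x x1 b)
    where
    x1 : 1 ≤ x
    x1 = ≤-trans (s≤s z≤n) a
    not-start : ¬ (x < C x)
    not-start lt = <⇒≱ a (+-cancelˡ-≤ k x B
      (≤-trans (start-length x x1 b lt) (≤-trans (partner-≤2n x x1 b) (≤-reflexive 2n≡k+B))))

  mid-start-ends-high : ∀ x → 1 ≤ x → x ≤ 2 * n → k < x → x < C x → B < C x
  mid-start-ends-high x a b c e = <-≤-trans (≤-<-trans B≤2k (+-monoʳ-< k c)) (start-length x a b e)

  mid-end-starts-low : ∀ x → 1 ≤ x → x ≤ B → C x < x → C x ≤ k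
  mid-end-starts-low x a b gt = ≤-trans (+-cancelˡ-≤ k (C x) (d + d)
    (≤-trans (end-length x a (≤-trans b B≤2n) gt) (≤-trans b (≤-reflexive B≡k+2d)))) 2d≤k

  -- A point x ∈ 1..k starts a chord of S_C iff B < C x; all
  -- other points of 1..k start a chord ending in M.  Sweeping the cut from k
  -- to 2n shows that exactly d of the points of 1..k are of the second kind,
  -- since the k points of 1..k, the 2d points of M and the k points beyond B
  -- are joined by chords low–M, low–high and M–high only.

  startsS : ℕ → Bool
  startsS x = B <ᵇ C x

  lowBeyond : ℕ → ℕ
  lowBeyond t = beyond t k

  crossing-k : crossing k ≡ k
  crossing-k = count-all _ k (λ x a b → <⇒<ᵇ≡true (<-≤-trans (m<m+n k a) (low-start x a b)))

  -- for k ≤ t ≤ B: crossing t + 2k = t + 2·lowBeyond t, because while the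
  -- cut runs through M every chord it closes goes from 1..k into M, and
  -- every chord it opens goes from M beyond B
  crossing-in-M : ∀ j → k + j ≤ B →
    crossing (k + j) + (k + k) ≡ (k + j) + (lowBeyond (k + j) + lowBeyond (k + j))
  crossing-in-M zero _ rewrite +-identityʳ k | crossing-k = refl
  crossing-in-M (suc j) t<B rewrite +-suc k j = step (crossing-in-M j (≤-trans (n≤1+n _) t<B))
    where
    t : ℕ
    t = k + j
    tN : suc t ≤ 2 * n
    tN = ≤-trans t<B B≤2n
    close : ∀ c t l → suc c + (k + k) ≡ t + (suc l + suc l) → c + (k + k) ≡ suc t + (l + l)
    close c t l e = suc-injective (trans e (lemma t l))
      where
      lemma : ∀ t l → t + (suc l + suc l) ≡ suc (suc t + (l + l))
      lemma = solve-∀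
    step : crossing t + (k + k) ≡ t + (lowBeyond t + lowBeyond t) →
           crossing (suc t) + (k + k) ≡ suc t + (lowBeyond (suc t) + lowBeyond (suc t))
    step ih with <-cmp (suc t) (C (suc t))
    ... | tri< lt _ _ rewrite crossing-start t tN lt
           | beyond-pass t k (start-partner-right t k (m≤m+n k j) tN lt) = cong suc ih
    ... | tri≈ _ e _ = ⊥-elim (partner-≢ (suc t) (s≤s z≤n) tN (sym e))
    ... | tri> _ _ gt = close (crossing (suc t)) t (lowBeyond (suc t))
          (subst₂ (λ a b → a + (k + k) ≡ t + (b + b)) (crossing-end t tN gt) low-closes ih)
      where
      low-closes : lowBeyond t ≡ suc (lowBeyond (suc t))
      low-closes = beyond-pass-partner t k (C (suc t)) (partner-≥1 (suc t) (s≤s z≤n) tN)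
        (mid-end-starts-low (suc t) (s≤s z≤n) t<B gt) k≤2n (involutive (suc t) (s≤s z≤n) tN)

  -- beyond B every point is an end point, so the k chords crossing the cut
  -- after B close one by one
  crossing-beyond-B : ∀ e j → e + j ≡ k → crossing (B + j) + j ≡ k
  crossing-beyond-B zero j refl
    rewrite +-comm B k | sym 2n≡k+B | crossing-at-end = refl
  crossing-beyond-B (suc e) j e+j≡k = trans step (crossing-beyond-B e (suc j) (trans (+-suc e j) e+j≡k))
    where
    t : ℕ
    t = B + j
    tN : suc t ≤ 2 * n
    tN = subst₂ _≤_ (+-suc B j) (trans (+-comm B k) (sym 2n≡k+B))
      (+-monoʳ-≤ B (subst (suc j ≤_) e+j≡k (s≤s (m≤n+m j e))))
    step : crossing t + j ≡ crossing (B + suc j) + suc j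
    step rewrite +-suc B j | crossing-end t tN (high-end (suc t) (s≤s (m≤m+n B j)) tN) = sym (+-suc _ j)

  low-to-M : countUpTo (λ x → not (startsS x)) k ≡ d
  low-to-M = +-cancelˡ-≡ S _ _ (trans (count-partition startsS k) (sym S+d≡k))
    where
    S : ℕ
    S = lowBeyond B
    crossing-B : crossing B ≡ k
    crossing-B = trans (sym (+-identityʳ _))
      (subst (λ z → crossing z + 0 ≡ k) (+-identityʳ B) (crossing-beyond-B k 0 (+-identityʳ k)))
    sweep : k + (k + k) ≡ (k + (d + d)) + (S + S)
    sweep = trans (cong (_+ (k + k)) (sym crossing-B))
      (trans (subst (λ z → crossing z + (k + k) ≡ z + (lowBeyond z + lowBeyond z)) (sym B≡k+2d)
               (crossing-in-M (d + d) (≤-reflexive (sym B≡k+2d))))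
             (cong (_+ (S + S)) B≡k+2d))
    S+d≡k : S + d ≡ k
    S+d≡k = sym (*-cancelˡ-≡ k (S + d) 2 (+-cancelˡ-≡ k _ _ (trans (triple k) (trans sweep (regroup k d S)))))
      where
      triple : ∀ k → k + 2 * k ≡ k + (k + k)
      triple = solve-∀
      regroup : ∀ k d S → (k + (d + d)) + (S + S) ≡ k + 2 * (S + d)
      regroup = solve-∀

  prefix-bound : ∀ p → p ≤ k → countUpTo startsS p ≤ d → p ≤ d + d
  prefix-bound p p≤k few = begin
    p                                                              ≡⟨ sym (count-partition _ p) ⟩
    countUpTo startsS p + countUpTo (λ x → not (startsS x)) p ≤⟨ +-mono-≤ few non-S ⟩
    d + d                                                          ∎
    where
    open ≤-Reasoning
    non-S : countUpTo (λ x → not (startsS x)) p ≤ d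
    non-S = ≤-trans (count-mono _ p≤k) (≤-reflexive low-to-M)

  data Block (x : ℕ) : Set where
    low : x ≤ k → Block x
    mid : k < x → x ≤ B → Block x
    high : B < x → Block x

  block : ∀ x → Block x
  block x with x ≤? k
  ... | yes a = low a
  ... | no a with x ≤? B
  ...   | yes b = mid (≰⇒> a) b
  ...   | no b = high (≰⇒> b)

  σ-low : ∀ x → x ≤ k → σ x ≡ x
  σ-low x h rewrite ≤⇒≤ᵇ≡true h = refl

  σ-mid : ∀ x → k < x → x ≤ B → σ x ≡ suc x
  σ-mid x h1 h2 rewrite >⇒≤ᵇ≡false h1 | ≤⇒≤ᵇ≡true h2 = refl

  σ-high : ∀ x → B < x → σ x ≡ suc (suc x)
  σ-high x h rewrite >⇒≤ᵇ≡false (≤-<-trans k≤B h) | >⇒≤ᵇ≡false h = refl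

  σinv-low : ∀ y → y ≤ k → σinv y ≡ y
  σinv-low y h rewrite ≤⇒≤ᵇ≡true h = refl

  σinv-mid : ∀ y → k < y → y ≤ suc B → σinv y ≡ pred y
  σinv-mid y h1 h2 rewrite >⇒≤ᵇ≡false h1 | ≤⇒≤ᵇ≡true h2 = refl

  σinv-high : ∀ y → suc B < y → σinv y ≡ y ∸ 2
  σinv-high y h rewrite >⇒≤ᵇ≡false (≤-<-trans (m≤n⇒m≤1+n k≤B) h) | >⇒≤ᵇ≡false h = refl

  σinv-σ : ∀ x → σinv (σ x) ≡ x
  σinv-σ x with block x
  ... | low a rewrite σ-low x a = σinv-low x a
  ... | mid a b rewrite σ-mid x a b = σinv-mid (suc x) (m≤n⇒m≤1+n a) (s≤s b)
  ... | high a rewrite σ-high x a = σinv-high (suc (suc x)) (s≤s (m≤n⇒m≤1+n a))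

  σ≢c-start : ∀ x → σ x ≢ suc k
  σ≢c-start x e with block x
  ... | low a = <⇒≢ (s≤s a) (trans (sym (σ-low x a)) e)
  ... | mid a b = <⇒≢ a (sym (suc-injective (trans (sym (σ-mid x a b)) e)))
  ... | high a = <⇒≢ (m<n⇒m<1+n (≤-<-trans k≤B a)) (sym (suc-injective (trans (sym (σ-high x a)) e)))

  σ≢c-end : ∀ x → σ x ≢ cEnd
  σ≢c-end x e with block x
  ... | low a = <⇒≢ (≤-trans (s≤s a) (≤-trans (m≤n⇒m≤1+n (s≤s k≤B)) (≤-reflexive (sym cEnd≡B+2))))
                    (trans (sym (σ-low x a)) e)
  ... | mid a b = <⇒≢ (≤-trans (s≤s (s≤s b)) (≤-reflexive (sym cEnd≡B+2))) (trans (sym (σ-mid x a b)) e)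
  ... | high a = <⇒≢ a (sym (suc-injective (suc-injective (trans (trans (sym (σ-high x a)) e) cEnd≡B+2))))

  σ-σinv : ∀ y → y ≢ suc k → y ≢ cEnd → σ (σinv y) ≡ y
  σ-σinv y n1 n2 with y ≤? k
  ... | yes a rewrite σinv-low y a = σ-low y a
  ... | no a with y ≤? suc B
  ...   | yes b = in-M y (≰⇒> a) b n1
    where
    in-M : ∀ y → k < y → y ≤ suc B → y ≢ suc k → σ (σinv y) ≡ y
    in-M (suc y) a b n1 rewrite σinv-mid (suc y) a b =
      σ-mid y (≤∧≢⇒< (≤-pred a) (λ e → n1 (cong suc (sym e)))) (≤-pred b)
  ...   | no b = in-high y (≰⇒> b) (λ e → n2 (trans e (sym cEnd≡B+2)))
    where
    in-high : ∀ y → suc B < y → y ≢ suc (suc B) → σ (σinv y) ≡ y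
    in-high (suc zero) (s≤s ()) n2
    in-high (suc (suc y)) b n2 rewrite σinv-high (suc (suc y)) b =
      σ-high y (≤∧≢⇒< (≤-pred (≤-pred b)) (λ e → n2 (cong (λ z → suc (suc z)) (sym e))))

  σ-≥ : ∀ x → x ≤ σ x
  σ-≥ x with block x
  ... | low a rewrite σ-low x a = ≤-refl
  ... | mid a b rewrite σ-mid x a b = n≤1+n x
  ... | high a rewrite σ-high x a = ≤-trans (n≤1+n x) (n≤1+n _)

  σ->k : ∀ x → k < x → suc x ≤ σ x
  σ->k x a with block x
  ... | low b = ⊥-elim (<⇒≱ a b)
  ... | mid b c rewrite σ-mid x b c = ≤-refl
  ... | high b rewrite σ-high x b = n≤1+n _

  σ-≤ : ∀ x → σ x ≤ suc (suc x)
  σ-≤ x with block x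
  ... | low b rewrite σ-low x b = ≤-trans (n≤1+n x) (n≤1+n _)
  ... | mid b c rewrite σ-mid x b c = n≤1+n _
  ... | high b rewrite σ-high x b = ≤-refl

  σ-mono : ∀ x y → x ≤ y → σ x ≤ σ y
  σ-mono x y le with block x | block y
  ... | low a | low b rewrite σ-low x a | σ-low y b = le
  ... | low a | mid b c rewrite σ-low x a | σ-mid y b c = m≤n⇒m≤1+n le
  ... | low a | high b rewrite σ-low x a | σ-high y b = m≤n⇒m≤1+n (m≤n⇒m≤1+n le)
  ... | mid a c | low b = ⊥-elim (<⇒≱ a (≤-trans le b))
  ... | mid a c | mid b e rewrite σ-mid x a c | σ-mid y b e = s≤s le
  ... | mid a c | high b rewrite σ-mid x a c | σ-high y b = m≤n⇒m≤1+n (s≤s le)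
  ... | high a | low b = ⊥-elim (<⇒≱ (≤-<-trans k≤B a) (≤-trans le b))
  ... | high a | mid b c = ⊥-elim (<⇒≱ a (≤-trans le c))
  ... | high a | high b rewrite σ-high x a | σ-high y b = s≤s (s≤s le)

  2[n+1]≡2n+2 : 2 * suc n ≡ suc (suc (2 * n))
  2[n+1]≡2n+2 = cong suc (+-suc n (n + 0))

  σ-range : ∀ x → 1 ≤ x → x ≤ 2 * n → (1 ≤ σ x) × (σ x ≤ 2 * suc n)
  σ-range x a b = ≤-trans a (σ-≥ x) ,
    ≤-trans (σ-≤ x) (subst (suc (suc x) ≤_) (sym 2[n+1]≡2n+2) (s≤s (s≤s b)))

  σinv-range : ∀ y → 1 ≤ y → y ≤ 2 * suc n → y ≢ suc k → y ≢ cEnd → (1 ≤ σinv y) × (σinv y ≤ 2 * n)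
  σinv-range y a b n1 n2 with y ≤? k
  ... | yes c rewrite σinv-low y c = a , ≤-trans c k≤2n
  ... | no c with y ≤? suc B
  ...   | yes e = in-M y (≰⇒> c) e n1
    where
    in-M : ∀ y → k < y → y ≤ suc B → y ≢ suc k → (1 ≤ σinv y) × (σinv y ≤ 2 * n)
    in-M (suc y) a b n1 rewrite σinv-mid (suc y) a b =
      ≤-trans (s≤s z≤n) (≤∧≢⇒< (≤-pred a) (λ e → n1 (cong suc (sym e)))) , ≤-trans (≤-pred b) B≤2n
  ...   | no e = in-high y (≰⇒> e) (λ q → n2 (trans q (sym cEnd≡B+2))) b
    where
    in-high : ∀ y → suc B < y → y ≢ suc (suc B) → y ≤ 2 * suc n → (1 ≤ σinv y) × (σinv y ≤ 2 * n)
    in-high (suc zero) (s≤s ()) n2 b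
    in-high (suc (suc y)) a n2 b rewrite σinv-high (suc (suc y)) a =
      ≤-trans (s≤s z≤n) (≤∧≢⇒< (≤-pred (≤-pred a)) (λ e → n2 (cong (λ z → suc (suc z)) (sym e)))) ,
      ≤-pred (≤-pred (subst (suc (suc y) ≤_) 2[n+1]≡2n+2 b))

  -- It is a linear chord diagram with n+1 chords, and every
  -- chord other than c has length ≥ k+1 (σ never shortens a chord, and it
  -- lengthens every chord crossing the gap at k+1).

  k+1≤cEnd : suc k ≤ cEnd
  k+1≤cEnd = ≤-trans (s≤s (≤-trans k≤B (n≤1+n B))) (≤-reflexive (sym cEnd≡B+2))

  cEnd≤2[n+1] : cEnd ≤ 2 * suc n
  cEnd≤2[n+1] = subst₂ _≤_ (sym cEnd≡B+2) (sym 2[n+1]≡2n+2) (s≤s (s≤s B≤2n))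

  cEnd>k+1 : ∀ x → x ≤ suc k → x < cEnd
  cEnd>k+1 x h = ≤-trans (s≤s h) (≤-trans (s≤s (s≤s k≤B)) (≤-reflexive (sym cEnd≡B+2)))

  Cstar-c-start : Cstar (suc k) ≡ cEnd
  Cstar-c-start rewrite ≡ᵇ-refl (suc k) = refl

  Cstar-c-end : Cstar cEnd ≡ suc k
  Cstar-c-end rewrite ≢⇒≡ᵇ≡false (≢-sym (<⇒≢ (cEnd>k+1 (suc k) ≤-refl))) | ≡ᵇ-refl cEnd = refl

  Cstar-old : ∀ y → y ≢ suc k → y ≢ cEnd → Cstar y ≡ σ (C (σinv y))
  Cstar-old y a b rewrite ≢⇒≡ᵇ≡false a | ≢⇒≡ᵇ≡false b = refl

  Cstar-low : ∀ x → x ≤ k → Cstar x ≡ σ (C x)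
  Cstar-low x b rewrite Cstar-old x (<⇒≢ (s≤s b)) (<⇒≢ (cEnd>k+1 x (m≤n⇒m≤1+n b))) | σinv-low x b = refl

  Cstar-startsS : ∀ x → 1 ≤ x → x ≤ k → isSStart Cstar x ≡ startsS x
  Cstar-startsS x a b
    rewrite Cstar-low x b
          | <⇒<ᵇ≡true (<-≤-trans (<-≤-trans (m<n+m x k≥1) (low-start x a b)) (σ-≥ (C x)))
          | ≢⇒≡ᵇ≡false (σ≢c-start (C x)) | ≢⇒≡ᵇ≡false (σ≢c-end (C x)) | σinv-σ (C x)
          | involutive x a (≤-trans b k≤2n) | ≥⇒<ᵇ≡false {k} {x} b
          | <⇒<ᵇ≡true {k} {C x} (<-≤-trans (m<m+n k a) (low-start x a b))
          | ∧-identityʳ (not (C x ≤ᵇ B)) = not-≤ᵇ (C x) B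
    where
    not-≤ᵇ : ∀ a b → not (a ≤ᵇ b) ≡ (b <ᵇ a)
    not-≤ᵇ a b with a ≤? b
    ... | yes p rewrite ≤⇒≤ᵇ≡true p | ≥⇒<ᵇ≡false {b} {a} p = refl
    ... | no p rewrite >⇒≤ᵇ≡false (≰⇒> p) | <⇒<ᵇ≡true {b} {a} (≰⇒> p) = refl

  Cstar-IsLCD : IsLCD (suc n) Cstar
  Cstar-IsLCD y a b with y ≟ suc k
  ... | yes refl rewrite Cstar-c-start =
    ≤-trans (s≤s z≤n) k+1≤cEnd , cEnd≤2[n+1] , ≢-sym (<⇒≢ (cEnd>k+1 y ≤-refl)) , Cstar-c-end
  ... | no n1 with y ≟ cEnd
  ...   | yes refl rewrite Cstar-c-end =
    s≤s z≤n , ≤-trans k+1≤cEnd cEnd≤2[n+1] , <⇒≢ (cEnd>k+1 (suc k) ≤-refl) , Cstar-c-start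
  ...   | no n2 rewrite Cstar-old y n1 n2 = proj₁ rng , proj₂ rng , no-fix , invol
    where
    z : ℕ
    z = σinv y
    z-rng : (1 ≤ z) × (z ≤ 2 * n)
    z-rng = σinv-range y a b n1 n2
    w : ℕ
    w = C z
    rng : (1 ≤ σ w) × (σ w ≤ 2 * suc n)
    rng = σ-range w (partner-≥1 z (proj₁ z-rng) (proj₂ z-rng)) (partner-≤2n z (proj₁ z-rng) (proj₂ z-rng))
    no-fix : σ w ≢ y
    no-fix e = partner-≢ z (proj₁ z-rng) (proj₂ z-rng) (trans (sym (σinv-σ w)) (cong σinv e))
    invol : Cstar (σ w) ≡ y
    invol rewrite Cstar-old (σ w) (σ≢c-start w) (σ≢c-end w) | σinv-σ w
                | involutive z (proj₁ z-rng) (proj₂ z-rng) = σ-σinv y n1 n2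

  Cstar-long : ∀ x → 1 ≤ x → x ≤ 2 * suc n → x < Cstar x → x ≢ suc k → suc k + x ≤ Cstar x
  Cstar-long x a b lt n1 with x ≟ cEnd
  ... | yes refl = ⊥-elim (<⇒≱ lt (subst (_≤ cEnd) (sym Cstar-c-end) k+1≤cEnd))
  ... | no n2 = subst₂ (λ u v → suc k + u ≤ v) (σ-σinv x n1 n2) (sym (Cstar-old x n1 n2)) σ-long
    where
    z : ℕ
    z = σinv x
    z-rng : (1 ≤ z) × (z ≤ 2 * n)
    z-rng = σinv-range x a b n1 n2
    z1 : 1 ≤ z
    z1 = proj₁ z-rng
    z2 : z ≤ 2 * n
    z2 = proj₂ z-rng
    σz<σCz : σ z < σ (C z)
    σz<σCz = subst₂ _<_ (sym (σ-σinv x n1 n2)) (Cstar-old x n1 n2) lt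
    z<Cz : z < C z
    z<Cz = ≤∧≢⇒< (≮⇒≥ (λ p → <⇒≱ σz<σCz (σ-mono (C z) z (<⇒≤ p)))) (≢-sym (partner-≢ z z1 z2))
    len : k + z ≤ C z
    len = start-length z z1 z2 z<Cz
    σ-long : suc k + σ z ≤ σ (C z)
    σ-long with block z
    ... | low p rewrite σ-low z p = ≤-trans (s≤s len) (σ->k (C z) (<-≤-trans (m<m+n k z1) len))
    ... | mid p q rewrite σ-mid z p q | σ-high (C z) (mid-start-ends-high z z1 z2 p z<Cz) =
          subst (_≤ suc (suc (C z))) (sym (+-suc (suc k) z)) (s≤s (s≤s len))
    ... | high p = ⊥-elim (<⇒≱ (high-end z p z2) (<⇒≤ z<Cz))

  Long : (ℕ → ℕ) → ℕ → Set
  Long D p = ∀ x → 1 ≤ x → x ≤ 2 * suc n → x < D x → x ≢ p → suc k + x ≤ D x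

  record Invariant (f : ℕ) (D : ℕ → ℕ) (p : ℕ) : Set where
    field
      diagram : IsLCD (suc n) D
      p≥1 : 1 ≤ p
      p≤k+1 : p ≤ suc k
      c-from-p : D p ≡ cEnd
      long : Long D p
      unchanged : ∀ x → 1 ≤ x → x < p → D x ≡ Cstar x
      -- each exchange removes one S_C start left of c, so f exchanges suffice
      fuel : countUpTo (isSStart D) (p ∸ 1) ≤ f

  isSStart-cong : ∀ D D′ x → D x ≡ D′ x → isSStart D x ≡ isSStart D′ x
  isSStart-cong D D′ x e = cong (λ z → (x <ᵇ z) ∧ inS z) e

  isSStart-left : ∀ {f D p} → Invariant f D p → ∀ x → 1 ≤ x → x < p → isSStart D x ≡ startsS x
  isSStart-left {D = D} I x a x<p = trans (isSStart-cong D Cstar x (Invariant.unchanged I x a x<p))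
    (Cstar-startsS x a (≤-pred (≤-trans x<p (Invariant.p≤k+1 I))))

  initial : Invariant (2 * n + 2) Cstar (suc k)
  initial = record
    { diagram = Cstar-IsLCD ; p≥1 = s≤s z≤n ; p≤k+1 = ≤-refl ; c-from-p = Cstar-c-start
    ; long = Cstar-long ; unchanged = λ x _ _ → refl
    ; fuel = ≤-trans (count-≤ _ k) (≤-trans k≤2n (m≤m+n (2 * n) 2)) }

  -- once at most d chords of S_C start left of c, c = {p, cEnd} is long too:
  -- p ≤ 2d + 1 by prefix-bound, and cEnd = k + 2d + 2
  finish : ∀ {f D p} → Invariant f D p → countUpTo (isSStart D) (p ∸ 1) ≤ d →
    IsLCD (suc n) D × MinLen (suc n) (suc k) D
  finish {p = zero} I _ = ⊥-elim (<⇒≱ (Invariant.p≥1 I) z≤n)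
  finish {D = D} {p = suc p′} I few = diagram , min-len
    where
    open Invariant I
    p′≤2d : p′ ≤ d + d
    p′≤2d = prefix-bound p′ (≤-pred p≤k+1)
      (subst (_≤ d) (count-cong _ _ p′ (λ x a b → isSStart-left I x a (s≤s b))) few)
    c-long : suc k + suc p′ ≤ D (suc p′)
    c-long = subst₂ (λ u v → u ≤ v) (sym (+-suc (suc k) p′))
      (sym (trans c-from-p (trans cEnd≡B+2 (cong (λ z → suc (suc z)) B≡k+2d))))
      (s≤s (s≤s (+-monoʳ-≤ k p′≤2d)))
    min-len : MinLen (suc n) (suc k) D
    min-len x a b lt with x ≟ suc p′
    ... | yes refl = m+n≤o⇒m≤o∸n (suc k) c-long
    ... | no ne = m+n≤o⇒m≤o∸n (suc k) (long x a b lt ne)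

  module Exchange {f D p′ q} (I : Invariant (suc f) D (suc p′))
                  (largest : largestUpTo (isSStart D) p′ ≡ just q) where
    open Invariant I
    open Largest (largest-just (isSStart D) p′ q largest)

    p : ℕ
    p = suc p′

    q<p : q < p
    q<p = s≤s q≤m

    q≤k : q ≤ k
    q≤k = ≤-trans q≤m (≤-pred p≤k+1)

    p≤2[n+1] : p ≤ 2 * suc n
    p≤2[n+1] = ≤-trans p≤k+1 (≤-trans k+1≤cEnd cEnd≤2[n+1])

    q≤2[n+1] : q ≤ 2 * suc n
    q≤2[n+1] = ≤-trans (<⇒≤ q<p) p≤2[n+1]

    D-involutive : ∀ x → 1 ≤ x → x ≤ 2 * suc n → D (D x) ≡ x
    D-involutive x a b = proj₂ (proj₂ (proj₂ (diagram x a b)))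

    B<Cq : B < C q
    B<Cq = <ᵇ≡true⇒< (trans (sym (isSStart-left I q q≥1 q<p)) Pq)

    e : ℕ
    e = suc (suc (C q))

    D-q : D q ≡ e
    D-q = trans (unchanged q q≥1 q<p) (trans (Cstar-low q q≤k) (σ-high (C q) B<Cq))

    k+1<e : suc k < e
    k+1<e = s≤s (s≤s (<⇒≤ (≤-<-trans k≤B B<Cq)))

    -- the moved chord {p, e} is long: either p′ = q, or p′ starts a chord
    -- ending in M, so e > B ≥ C p′ ≥ k + p′
    k+p′≤Cq : k + p′ ≤ C q
    k+p′≤Cq with p′ ≟ q
    ... | yes refl = low-start p′ q≥1 q≤k
    ... | no p′≢q = ≤-trans (low-start p′ p′≥1 (≤-pred p≤k+1)) (≤-trans Cp′≤B (<⇒≤ B<Cq))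
      where
      q<p′ : q < p′
      q<p′ = ≤∧≢⇒< q≤m (p′≢q ∘ sym)
      p′≥1 : 1 ≤ p′
      p′≥1 = ≤-trans q≥1 (<⇒≤ q<p′)
      Cp′≤B : C p′ ≤ B
      Cp′≤B = <ᵇ≡false⇒≥ (trans (sym (isSStart-left I p′ p′≥1 ≤-refl)) (above p′ q<p′ ≤-refl))

    moved-long : suc k + p ≤ e
    moved-long = subst (_≤ e) (sym (+-suc (suc k) p′)) (s≤s (s≤s k+p′≤Cq))

    D′ : ℕ → ℕ
    D′ = swapPts p q D

    τ-other : ∀ y → y ≢ p → y ≢ q → transposition p q y ≡ y
    τ-other = transposition-other p q

    D′-q : D′ q ≡ cEnd
    D′-q rewrite transposition-q p q | c-from-p =
      τ-other cEnd (≢-sym (<⇒≢ (cEnd>k+1 p p≤k+1))) (≢-sym (<⇒≢ (cEnd>k+1 q (≤-trans q≤k (n≤1+n k)))))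

    D′-p : D′ p ≡ e
    D′-p rewrite transposition-p p q | D-q =
      τ-other e (≢-sym (<⇒≢ (≤-<-trans p≤k+1 k+1<e))) (≢-sym (<⇒≢ (≤-<-trans (≤-trans q≤k (n≤1+n k)) k+1<e)))

    D′-other : ∀ x → x ≢ p → x ≢ q → D x ≢ p → D x ≢ q → D′ x ≡ D x
    D′-other x xp xq Dxp Dxq rewrite τ-other x xp xq = τ-other (D x) Dxp Dxq

    partner-of-p : ∀ x → 1 ≤ x → x ≤ 2 * suc n → D x ≡ p → x ≡ cEnd
    partner-of-p x a b h = trans (sym (D-involutive x a b)) (trans (cong D h) c-from-p)

    partner-of-q : ∀ x → 1 ≤ x → x ≤ 2 * suc n → D x ≡ q → x ≡ e
    partner-of-q x a b h = trans (sym (D-involutive x a b)) (trans (cong D h) D-q)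

    agrees-left : ∀ x → 1 ≤ x → x < q → D′ x ≡ D x
    agrees-left x a x<q = D′-other x (<⇒≢ (<-trans x<q q<p)) (<⇒≢ x<q)
      (λ h → <⇒≢ (cEnd>k+1 x x≤k+1) (partner-of-p x a xN h))
      (λ h → <⇒≢ (<-trans x<q (≤-<-trans (≤-trans q≤k (n≤1+n k)) k+1<e)) (partner-of-q x a xN h))
      where
      x≤k+1 : x ≤ suc k
      x≤k+1 = ≤-trans (<⇒≤ x<q) (≤-trans q≤k (n≤1+n k))
      xN : x ≤ 2 * suc n
      xN = ≤-trans (<⇒≤ x<q) q≤2[n+1]

    long′ : Long D′ q
    long′ x a b lt x≢q with x ≟ p
    ... | yes refl = subst (suc k + p ≤_) (sym D′-p) moved-long
    ... | no x≢p with D x ≟ p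
    ...   | yes h = ⊥-elim (<⇒≱ lt (≤-trans (≤-reflexive D′x≡q)
                      (<⇒≤ (subst (q <_) (sym (partner-of-p x a b h)) (cEnd>k+1 q (≤-trans q≤k (n≤1+n k)))))))
      where
      D′x≡q : D′ x ≡ q
      D′x≡q rewrite τ-other x x≢p x≢q | h = transposition-p p q
    ...   | no Dx≢p with D x ≟ q
    ...     | yes h = ⊥-elim (<⇒≱ lt (≤-trans (≤-reflexive D′x≡p)
                        (<⇒≤ (subst (p <_) (sym (partner-of-q x a b h)) (≤-<-trans p≤k+1 k+1<e)))))
      where
      D′x≡p : D′ x ≡ p
      D′x≡p rewrite τ-other x x≢p x≢q | h = transposition-q p q
    ...     | no Dx≢q = subst (suc k + x ≤_) (sym same) (long x a b (subst (x <_) same lt) x≢p)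
      where
      same : D′ x ≡ D x
      same = D′-other x x≢p x≢q Dx≢p Dx≢q

    next : Invariant f D′ q
    next = record
      { diagram = swap-IsLCD (suc n) D p q diagram (s≤s z≤n) p≤2[n+1] q≥1 q≤2[n+1]
      ; p≥1 = q≥1 ; p≤k+1 = ≤-trans q≤k (n≤1+n k) ; c-from-p = D′-q ; long = long′
      ; unchanged = λ x a x<q → trans (agrees-left x a x<q) (unchanged x a (<-trans x<q q<p))
      ; fuel = subst (_≤ f) (sym (count-cong _ _ (pred q) agrees))
                 (≤-pred (subst (_≤ suc f) count-below fuel)) }
      where
      agrees : ∀ x → 1 ≤ x → x ≤ pred q → isSStart D′ x ≡ isSStart D x
      agrees x a b = isSStart-cong D′ D x (agrees-left x a (m≤pred[n]⇒suc[m]≤n {{>-nonZero q≥1}} b))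

  -- run stops with at most i ≤ d S_C starts left of c (or none left, or no
  -- fuel left, which by the fuel invariant also means none left), and every
  -- exchange preserves the invariant
  run-correct : ∀ f D p → Invariant f D p → IsLCD (suc n) (run f D p) × MinLen (suc n) (suc k) (run f D p)
  run-correct zero D p I = finish I (≤-trans (Invariant.fuel I) z≤n)
  run-correct (suc f) D zero I = ⊥-elim (<⇒≱ (Invariant.p≥1 I) z≤n)
  run-correct (suc f) D (suc p′) I with countUpTo (isSStart D) p′ ≡ᵇ i in reached
  ... | true = finish I (≤-trans (≤-reflexive (≡ᵇ≡true⇒≡ reached)) i≤d)
  ... | false with largestUpTo (isSStart D) p′ in largest
  ...   | nothing = finish I (≤-trans (≤-reflexive (largest-nothing _ p′ largest)) z≤n)
  ...   | just q = run-correct f (swapPts (suc p′) q D) q (Exchange.next I largest)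

  α-correct : IsLCD (suc n) (α n k i C) × MinLen (suc n) (suc k) (α n k i C)
  α-correct = run-correct (2 * n + 2) Cstar (suc k) initial

lemma4 : (n k i : ℕ) (C : ℕ → ℕ) →
    1 ≤ n → 1 ≤ k → k ≤ n → 3 * (n ∸ k) ≤ n → i ≤ n ∸ k →
    IsLCD n C → MinLen n k C →
    IsLCD (suc n) (α n k i C) × MinLen (suc n) (suc k) (α n k i C)
lemma4 n k i C _ k≥1 k≤n 3d≤n i≤d lcd minLen =
  Construction.α-correct n k i C k≥1 k≤n 3d≤n i≤d lcd minLen
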